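{- Let $0=s_1<\dots<s_k$ be integers, $S=\{s_1,\dots,s_k\}$, $\bar s=s_k$, $n\ge 2\bar s$. Let $A=(\alpha_{X,X'})_{X,X'\in\mathcal P}$ be the $2^{2\bar s}\times2^{2\bar s}$ matrix whose rows and columns are indexed by $\mathcal P$ in a consistent ordering. Then there is a $2^{\bar s}\times 2^{\bar s}$ matrix $\bar A$ such that $A=\mathrm{diag}(\bar A,\bar A,\dots,\bar A)$ is block diagonal with $2^{\bar s}$ copies of $\bar A$ on its diagonal.
   Context: $\mathcal P$ is the set of pairs $(L,R)$ of binary $\bar s$-tuples, i.e. tuples $(A(0),\dots,A(\bar s-1))$ with entries in $\{0,1\}$. A linear ordering $<$ on $\mathcal P$ is consistent if there are linear orderings $\le_L$ and $\le_R$ on binary $\bar s$-tuples such that $(L_1,R_1)<(L_2,R_2)$ iff either $L_1<_L L_2$, or $L_1=L_2$ and $R_1<_R R_2$. $\mathrm{New}(n)=\{(n-t,n):t\in S\}$ is the set of edges of the lattice graph $L_{n+1}$ (vertices $0,\dots,n$, edges $(i,j)$ with $j-i\in S$) that are not edges of $L_n$. Put $R(n)=\{n-\bar s,\dots,n-1\}$. $\mathrm{ID}_{S'},\mathrm{OD}_{S'}$ are in- and out-degrees in the edge set $S'$. For $X=(L,R)$, $X'=(L',R')\in\mathcal P$ and $S'\subseteq\mathrm{New}(n)$, let $od(n-1-i)=R'(i)+\mathrm{OD}_{S'}(n-1-i)$ for $0\le i<\bar s$, $od(n)=\mathrm{OD}_{S'}(n)$, $id(n)=\mathrm{ID}_{S'}(n)$.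 Set $\alpha_{X,X',S'}=1$ if: $od\le1$ on $R(n)\cup\{n\}$; $id(n)=1$; $od(n-\bar s)=1$; $L=L'$; and $R(i)=od(n-i)$ for all $0\le i<\bar s$. Otherwise $\alpha_{X,X',S'}=0$. Finally $\alpha_{X,X'}=\sum_{S'\subseteq\mathrm{New}(n)}\alpha_{X,X',S'}$. (Equivalently, $\alpha_{X,X'}$ counts the $S'$ such that, for a legal cover of $L_n$ with classification $X'$, adding $S'$ gives a legal cover of $L_{n+1}$ with classification $X$.) -}

module Defs where

open import Data.Nat using (ℕ; zero; suc; _+_; _*_; _∸_; _^_; _≤ᵇ_; _≡ᵇ_)
open import Data.Bool using (Bool; true; false; _∧_; if_then_else_)
import Data.Bool as B
open import Data.Fin as F using (Fin; toℕ; fromℕ; remQuot)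
open import Data.Vec using (Vec; []; _∷_; lookup)
open import Data.Vec.Properties using (≡-dec)
open import Data.Nat.ListAction using (sum)
open import Data.List using (List; []; _∷_; map; length; allFin; filterᵇ; _++_)
open import Data.Bool.ListAction using (and)
open import Data.Product using (_×_; _,_; proj₁; proj₂)
open import Relation.Nullary.Decidable using (⌊_⌋)
open import Function.Bundles using (_↔_; Inverse)

b2n : Bool → ℕ
b2n false = 0
b2n true  = 1

Tuple : ℕ → Set
Tuple m = Vec Bool m

𝒫 : ℕ → Set
𝒫 m = Tuple m × Tuple m

allVecs : (m : ℕ) → List (Vec Bool m)
allVecs zero    = [] ∷ []
allVecs (suc m) = map (false ∷_) (allVecs m) ++ map (true ∷_) (allVecs m)

-- Total lookup on a tuple with a natural-number index (false out of range;
-- only ever used in range).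
lookupℕ : {m : ℕ} → Vec Bool m → ℕ → Bool
lookupℕ []       _       = false
lookupℕ (b ∷ v)  zero    = b
lookupℕ (b ∷ v)  (suc i) = lookupℕ v i

-- The set S = {s 0 , ... , s k}  (paper: s_1 < ... < s_{k}; here k+1 elements
-- indexed by Fin (suc k)), s̄ = largest element.
sbar : (k : ℕ) → (Fin (suc k) → ℕ) → ℕ
sbar k s = s (fromℕ k)

-- New(n) = { (n - s i , n) : i }.  A subset S' ⊆ New(n) is encoded as a
-- Vec Bool (suc k): bit i says the edge (n ∸ s i , n) belongs to S'.
-- (Edges are directed from the smaller endpoint n ∸ s i to n.)

OD : (k : ℕ) (s : Fin (suc k) → ℕ) (n : ℕ) (S' : Vec Bool (suc k)) (v : ℕ) → ℕ
OD k s n S' v =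
  sum (map (λ i → if lookup S' i ∧ ((n ∸ s i) ≡ᵇ v) then 1 else 0) (allFin (suc k)))

ID : (k : ℕ) (s : Fin (suc k) → ℕ) (n : ℕ) (S' : Vec Bool (suc k)) (v : ℕ) → ℕ
ID k s n S' v =
  sum (map (λ i → if lookup S' i ∧ (n ≡ᵇ v) then 1 else 0) (allFin (suc k)))

-- od at vertex n ∸ d, for offsets 0 ≤ d ≤ s̄:
--   od(n)       = OD_{S'}(n)
--   od(n-1-i)   = R'(i) + OD_{S'}(n-1-i)      (0 ≤ i < s̄)
odAt : (k : ℕ) (s : Fin (suc k) → ℕ) (n : ℕ) (R' : Tuple (sbar k s))
       (S' : Vec Bool (suc k)) → ℕ → ℕ
odAt k s n R' S' zero    = OD k s n S' n
odAt k s n R' S' (suc i) = b2n (lookupℕ R' i) + OD k s n S' (n ∸ suc i)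

αS : (k : ℕ) (s : Fin (suc k) → ℕ) (n : ℕ) (X X' : 𝒫 (sbar k s))
     (S' : Vec Bool (suc k)) → Bool
αS k s n (L , R) (L' , R') S' =
     and (map (λ d → od (toℕ d) ≤ᵇ 1) (allFin (suc sb)))
   ∧ (ID k s n S' n ≡ᵇ 1)
   ∧ (od sb ≡ᵇ 1)
   ∧ ⌊ ≡-dec B._≟_ L L' ⌋
   ∧ and (map (λ i → b2n (lookup R i) ≡ᵇ od (toℕ i)) (allFin sb))
  where
    sb = sbar k s
    od = odAt k s n R' S'

α : (k : ℕ) (s : Fin (suc k) → ℕ) (n : ℕ) (X X' : 𝒫 (sbar k s)) → ℕ
α k s n X X' = length (filterᵇ (αS k s n X X') (allVecs (suc k)))

-- A consistent linear ordering of 𝒫 is given by linear orderings ≤_L, ≤_R of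
-- the tuples, i.e. by enumerations eL, eR : Fin (2^s̄) ↔ tuples; the pair
-- (L , R) then sits at position  posL(L) * 2^s̄ + posR(R)  (lexicographic).
decode : {m : ℕ} → (Fin (2 ^ m) ↔ Tuple m) → (Fin (2 ^ m) ↔ Tuple m)
         → Fin (2 ^ m * 2 ^ m) → 𝒫 m
decode {m} eL eR p = Inverse.to eL (proj₁ (remQuot {2 ^ m} (2 ^ m) p))
                   , Inverse.to eR (proj₂ (remQuot {2 ^ m} (2 ^ m) p))

Amat : (k : ℕ) (s : Fin (suc k) → ℕ) (n : ℕ)
       (eL eR : Fin (2 ^ sbar k s) ↔ Tuple (sbar k s))
       → Fin (2 ^ sbar k s * 2 ^ sbar k s) → Fin (2 ^ sbar k s * 2 ^ sbar k s) → ℕ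
Amat k s n eL eR p q = α k s n (decode eL eR p) (decode eL eR q)

blockDiag : (c b : ℕ) → (Fin b → Fin b → ℕ) → Fin (c * b) → Fin (c * b) → ℕ
blockDiag c b B p q with remQuot {c} b p | remQuot {c} b q
... | (i , j) | (i' , j') = if ⌊ i F.≟ i' ⌋ then B j j' else 0

module Submission where

-- Idea. Among the conditions defining α_{X,X',S'} for X = (L , R), X' = (L' , R'),
-- the only one that looks at L or L' is "L = L'"; all others involve only R, R' and
-- S'.  Hence α_{(L,R),(L',R')} vanishes when L ≠ L', and for L = L' it does not
-- depend on L at all.  Fixing an arbitrary L₀ and putting
--   ᾱ(R , R') = α_{(L₀,R),(L₀,R')}
-- we get α_{(L,R),(L',R')} = [L = L'] · ᾱ(R , R')  (lemma α-factorises).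
-- In a consistent ordering the pair (L , R) sits at position posL(L)·2^s̄ + posR(R),
-- so its block index is posL(L); as posL is a bijection, "L = L'" is the same test
-- as "the block indices agree", which is exactly diag(Ā, …, Ā) with Ā = ᾱ read
-- through the ordering of the R-tuples.

open import Defs
open import Data.Nat using (ℕ; suc; _*_; _^_; _≤_; _<_; _≤ᵇ_; _≡ᵇ_)
open import Data.Fin as F using (Fin; zero; toℕ; remQuot)
open import Data.Bool using (Bool; true; false; T; _∧_; if_then_else_)
import Data.Bool as B
open import Data.Bool.Properties using (∧-zeroʳ)
open import Data.Bool.ListAction using (and)
open import Data.Vec using (Vec; lookup; replicate)
open import Data.Vec.Properties using (≡-dec)
open import Data.List using (List; []; _∷_; map; length; allFin; filterᵇ)
open import Data.List.Properties using (filter-≐)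
open import Data.Product using (Σ; _,_; proj₁; proj₂)
open import Function using (_∘_)
open import Function.Bundles using (_↔_; Inverse; Injection)
open import Function.Properties.Inverse using (↔⇒↣)
open import Relation.Nullary using (¬_; Dec; yes; no)
open import Relation.Nullary.Decidable using (⌊_⌋; isYes≗does; dec-true; dec-false)
open import Relation.Binary.Definitions using (DecidableEquality)
open import Relation.Binary.PropositionalEquality
  using (_≡_; refl; sym; trans; cong; subst; module ≡-Reasoning)

open ≡-Reasoning

filterᵇ-cong : {A : Set} {p q : A → Bool} → (∀ x → p x ≡ q x) →
               (xs : List A) → filterᵇ p xs ≡ filterᵇ q xs
filterᵇ-cong {p = p} {q} p≗q =
  filter-≐ (B.T? ∘ p) (B.T? ∘ q)
    ((λ {x} → subst T (p≗q x)) , (λ {x} → subst T (sym (p≗q x))))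

filterᵇ-reject-all : {A : Set} (xs : List A) → filterᵇ (λ _ → false) xs ≡ []
filterᵇ-reject-all []       = refl
filterᵇ-reject-all (_ ∷ xs) = filterᵇ-reject-all xs

⌊⌋-true : {A : Set} (a? : Dec A) → A → ⌊ a? ⌋ ≡ true
⌊⌋-true a? a = trans (isYes≗does a?) (dec-true a? a)

⌊⌋-false : {A : Set} (a? : Dec A) → ¬ A → ⌊ a? ⌋ ≡ false
⌊⌋-false a? ¬a = trans (isYes≗does a?) (dec-false a? ¬a)

⌊⌋-injective : {A B : Set} (_≟ᴬ_ : DecidableEquality A) (_≟ᴮ_ : DecidableEquality B)
               {f : A → B} → (∀ {x y} → f x ≡ f y → x ≡ y) →
               ∀ x y → ⌊ f x ≟ᴮ f y ⌋ ≡ ⌊ x ≟ᴬ y ⌋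
⌊⌋-injective _≟ᴬ_ _≟ᴮ_ {f} f-inj x y with x ≟ᴬ y
... | yes refl = ⌊⌋-true (f x ≟ᴮ f x) refl
... | no  x≢y  = ⌊⌋-false (f x ≟ᴮ f y) (x≢y ∘ f-inj)

_≟ᵀ_ : {m : ℕ} → DecidableEquality (Tuple m)
_≟ᵀ_ = ≡-dec B._≟_

-- α_{X,X',S'} with its condition "L = L'" replaced by an arbitrary Boolean b;
-- by definition αS (L , R) (L' , R') S' is αCore R R' S' ⌊ L ≟ᵀ L' ⌋.
αCore : (k : ℕ) (s : Fin (suc k) → ℕ) (n : ℕ) (R R' : Tuple (sbar k s))
        (S' : Vec Bool (suc k)) → Bool → Bool
αCore k s n R R' S' b =
     and (map (λ d → od (toℕ d) ≤ᵇ 1) (allFin (suc (sbar k s))))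
   ∧ (ID k s n S' n ≡ᵇ 1)
   ∧ (od (sbar k s) ≡ᵇ 1)
   ∧ b
   ∧ and (map (λ i → b2n (lookup R i) ≡ᵇ od (toℕ i)) (allFin (sbar k s)))
  where
    od = odAt k s n R' S'

αCore-false : ∀ k s n R R' S' → αCore k s n R R' S' false ≡ false
αCore-false k s n R R' S' = begin
  a ∧ b ∧ c ∧ false  ≡⟨ cong (λ x → a ∧ b ∧ x) (∧-zeroʳ c) ⟩
  a ∧ b ∧ false      ≡⟨ cong (a ∧_) (∧-zeroʳ b) ⟩
  a ∧ false          ≡⟨ ∧-zeroʳ a ⟩
  false              ∎
  where
    od = odAt k s n R' S'
    a = and (map (λ d → od (toℕ d) ≤ᵇ 1) (allFin (suc (sbar k s))))
    b = ID k s n S' n ≡ᵇ 1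
    c = od (sbar k s) ≡ᵇ 1

ᾱ : (k : ℕ) (s : Fin (suc k) → ℕ) (n : ℕ) (R R' : Tuple (sbar k s)) → ℕ
ᾱ k s n R R' = α k s n (L₀ , R) (L₀ , R')
  where L₀ = replicate (sbar k s) false

α-factorises : ∀ k s n L R L' R' →
               α k s n (L , R) (L' , R') ≡ (if ⌊ L ≟ᵀ L' ⌋ then ᾱ k s n R R' else 0)
α-factorises k s n L R L' R' with L ≟ᵀ L'
... | yes refl = cong length (filterᵇ-cong sameTest (allVecs (suc k)))
  where
    L₀ = replicate (sbar k s) false
    -- The test on (L₀ , L₀) succeeds, as the one on (L , L) did.
    sameTest : ∀ S' → αCore k s n R R' S' true ≡ αCore k s n R R' S' ⌊ L₀ ≟ᵀ L₀ ⌋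
    sameTest S' = cong (αCore k s n R R' S') (sym (⌊⌋-true (L₀ ≟ᵀ L₀) refl))
... | no _ = begin
  length (filterᵇ (λ S' → αCore k s n R R' S' false) (allVecs (suc k)))
    ≡⟨ cong length (filterᵇ-cong (αCore-false k s n R R') (allVecs (suc k))) ⟩
  length (filterᵇ (λ _ → false) (allVecs (suc k)))
    ≡⟨ cong length (filterᵇ-reject-all (allVecs (suc k))) ⟩
  0 ∎

-- Both Amat and blockDiag read a position p through
-- remQuot p = (block index i , offset j), so it suffices to compare entries per (i , j).
lemma6 : (k : ℕ) (s : Fin (suc k) → ℕ)
    → s zero ≡ 0
    → (∀ (i j : Fin (suc k)) → i F.< j → s i < s j)
    → (n : ℕ) → 2 * sbar k s ≤ n
    → (eL eR : Fin (2 ^ sbar k s) ↔ Tuple (sbar k s))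
    → Σ (Fin (2 ^ sbar k s) → Fin (2 ^ sbar k s) → ℕ) (λ Ā →
    ∀ p q → Amat k s n eL eR p q ≡ blockDiag (2 ^ sbar k s) (2 ^ sbar k s) Ā p q)
lemma6 k s _ _ n _ eL eR = Ā , λ p q →
    entry (proj₁ (remQuot {2 ^ m} (2 ^ m) p)) (proj₂ (remQuot {2 ^ m} (2 ^ m) p))
          (proj₁ (remQuot {2 ^ m} (2 ^ m) q)) (proj₂ (remQuot {2 ^ m} (2 ^ m) q))
  where
    m = sbar k s
    toL = Inverse.to eL
    toR = Inverse.to eR

    Ā : Fin (2 ^ m) → Fin (2 ^ m) → ℕ
    Ā j j' = ᾱ k s n (toR j) (toR j')

    entry : ∀ i j i' j' → α k s n (toL i , toR j) (toL i' , toR j')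
                          ≡ (if ⌊ i F.≟ i' ⌋ then Ā j j' else 0)
    entry i j i' j' = begin
      α k s n (toL i , toR j) (toL i' , toR j')
        ≡⟨ α-factorises k s n (toL i) (toR j) (toL i') (toR j') ⟩
      (if ⌊ toL i ≟ᵀ toL i' ⌋ then Ā j j' else 0)
        ≡⟨ cong (λ b → if b then Ā j j' else 0)
                (⌊⌋-injective F._≟_ _≟ᵀ_ (Injection.injective (↔⇒↣ eL)) i i') ⟩
      (if ⌊ i F.≟ i' ⌋ then Ā j j' else 0) ∎
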